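{- Let $T$ be a circle-tree and suppose that the sequences of circles $(C(i):i<k)$ and $(C'(i):i<k)$ both determine $T$. Then there is a bijection $f:\{0,\dots,k-1\}\to\{0,\dots,k-1\}$ such that $C(i)=C'(f(i))$ for every $i<k$.
   Context: All graphs are finite simple graphs. A circle is a finite connected graph in which every vertex has degree exactly $2$. For disjoint graphs $G,H$ with $\Delta(G),\Delta(H)\le3$ and vertices $x\in G$, $y\in H$ of degree $2$ in their respective graphs, $G+_{x,y}H$ is the disjoint union of $G$ and $H$ with the single extra edge $\{x,y\}$. A finite graph $T$ is a circle-tree determined by circles $(C(i):i<k)$ if $T(0)=C(0)$, for each $0<i<k$ the circle $C(i)$ is disjoint from $T(i-1)$ and $T(i)=T(i-1)+_{x,y}C(i)$ for some $x\in T(i-1)$ of degree $2$ in $T(i-1)$ and $y\in C(i)$, and $T=T(k-1)$. -}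

module Defs where

open import Data.Nat using (ℕ; zero; suc; _+_; _≤_; _<_; _≡ᵇ_)
open import Data.Bool using (Bool; true; false; _∨_; _∧_; if_then_else_)
open import Data.Product using (Σ; ∃; _×_; _,_)
open import Relation.Binary.PropositionalEquality using (_≡_)
open import Data.Empty using (⊥)

record Graph : Set where
  field
    V       : ℕ → Bool
    E       : ℕ → ℕ → Bool
    bound   : ℕ
    bounded : ∀ x → V x ≡ true → x < bound
    E-sym   : ∀ x y → E x y ≡ E y x
    E-irr   : ∀ x → E x x ≡ false
    E-V     : ∀ x y → E x y ≡ true → V x ≡ true
open Graph public

_≅_ : Graph → Graph → Set
G ≅ H = (∀ x → V G x ≡ V H x) × (∀ x y → E G x y ≡ E H x y)

count : (ℕ → Bool) → ℕ → ℕ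
count f zero    = 0
count f (suc n) = count f n + (if f n then 1 else 0)

-- degree of x in G (all neighbours of x are < bound G)
deg : Graph → ℕ → ℕ
deg G x = count (E G x) (bound G)

MaxDeg≤3 : Graph → Set
MaxDeg≤3 G = ∀ x → V G x ≡ true → deg G x ≤ 3

data Walk (G : Graph) : ℕ → ℕ → Set where
  here : ∀ {x} → V G x ≡ true → Walk G x x
  step : ∀ {x y z} → E G x y ≡ true → Walk G y z → Walk G x z

-- connected graphs are nonempty
Connected : Graph → Set
Connected G = (∃ λ x → V G x ≡ true)
            × (∀ x y → V G x ≡ true → V G y ≡ true → Walk G x y)

IsCircle : Graph → Set
IsCircle G = Connected G × (∀ x → V G x ≡ true → deg G x ≡ 2)

Disjoint : Graph → Graph → Set
Disjoint G H = ∀ x → V G x ≡ true → V H x ≡ false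

-- S is G +_{x,y} H  (as a graph: same vertices and edges)
IsJoin : Graph → Graph → ℕ → ℕ → Graph → Set
IsJoin G H x y S =
    (∀ z → V S z ≡ (V G z ∨ V H z))
  × (∀ a b → E S a b ≡ (E G a b ∨ E H a b ∨ ((a ≡ᵇ x) ∧ (b ≡ᵇ y)) ∨ ((a ≡ᵇ y) ∧ (b ≡ᵇ x))))

JoinOK : Graph → Graph → ℕ → ℕ → Set
JoinOK G H x y = Disjoint G H × MaxDeg≤3 G × MaxDeg≤3 H
               × V G x ≡ true × deg G x ≡ 2 × V H y ≡ true × deg H y ≡ 2

-- Stage C i T : T is (up to graph equality) the stage T(i) built from circles C 0, …, C i
data Stage (C : ℕ → Graph) : ℕ → Graph → Set where
  base : ∀ {T} → IsCircle (C 0) → C 0 ≅ T → Stage C 0 T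
  step : ∀ {i T T' x y} → Stage C i T → IsCircle (C (suc i))
       → JoinOK T (C (suc i)) x y → IsJoin T (C (suc i)) x y T'
       → Stage C (suc i) T'

-- T is a circle-tree determined by the circles (C i : i < k)
Determines : (C : ℕ → Graph) → ℕ → Graph → Set
Determines C zero    T = ⊥
Determines C (suc m) T = Stage C m T

{-# OPTIONS --safe #-}
module Submission where

-- Call a symmetric edge set even if every vertex meets an even number of its edges. By the
-- handshake count, an even edge set leaves every vertex set through an even number of edges.
-- In T(i) = T(i-1) +_{x,y} C(i) the edge {x,y} would be the only edge leaving C(i), so it lies
-- in no even edge set, and by induction along the construction every edge of an even edge set
-- of T is an edge of one of the circles. Each C(i) is an even edge set of T, so its edges at a
-- vertex of C'(j) are edges of C'(j); as C(i) is connected, C(i) ⊆ C'(j) once they share a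
-- vertex, and symmetrically. The circles of a decomposition being disjoint, sending C(i) to the
-- circle C'(j) that meets it is the required bijection.

open import Defs
open import Data.Nat using (ℕ; zero; suc; _+_; _<_; _≤′_; ≤′-refl; ≤′-step; _≡ᵇ_; s≤s)
open import Data.Nat.Properties
  using ( +-identityʳ; +-assoc; +-commutativeSemigroup; ≤-refl; m≤n⇒m≤1+n; ≤⇒≯; <⇒≢; >⇒≢
        ; ≤′⇒≤; ≤⇒≤′; z≤′n; m≤′m+n; n≤′m+n; ≡ᵇ⇒≡ )
open import Data.Nat.Divisibility using (_∣_; _∣0; ∣-reflexive; m∣m*n; ∣m∣n⇒∣m+n; ∣m+n∣m⇒∣n; ∣1⇒≡1)
open import Algebra.Properties.CommutativeSemigroup +-commutativeSemigroup using (interchange)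
open import Data.Bool using (Bool; true; false; _∨_; _∧_; not; if_then_else_)
open import Data.Bool.Properties using (∨-zeroʳ; not-injective; T-≡)
open import Data.Fin using (Fin; toℕ; fromℕ<)
open import Data.Fin.Properties using (toℕ-fromℕ<; toℕ-injective; toℕ≤pred[n])
open import Data.Product using (Σ; Σ-syntax; ∃-syntax; _×_; _,_; proj₁; proj₂; map₁; map₂)
open import Data.Sum as Sum using (_⊎_; inj₁; inj₂; [_,_]′)
open import Data.Empty using (⊥-elim)
open import Function using (_∘_)
open import Function.Bundles using (_↔_; Inverse; mk↔ₛ′; Equivalence)
open import Relation.Nullary using (contradiction)
open import Relation.Binary.PropositionalEquality
  using (_≡_; _≢_; refl; sym; trans; cong; cong₂; subst; module ≡-Reasoning)

≡false⇒≢true : ∀ {b} → b ≡ false → b ≢ true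
≡false⇒≢true refl ()

∨-true⁻ : ∀ a {b} → a ∨ b ≡ true → a ≡ true ⊎ b ≡ true
∨-true⁻ true  _ = inj₁ refl
∨-true⁻ false p = inj₂ p

∧-true⁻ : ∀ a {b} → a ∧ b ≡ true → a ≡ true × b ≡ true
∧-true⁻ true p = refl , p

≡true-ext : ∀ {a b} → (a ≡ true → b ≡ true) → (b ≡ true → a ≡ true) → a ≡ b
≡true-ext {false} {false} _ _ = refl
≡true-ext {false} {true}  _ g = g refl
≡true-ext {true}  {false} f _ = sym (f refl)
≡true-ext {true}  {true}  _ _ = refl

∧-≡ᵇ⇒≡×≡ : ∀ {a b x y} → (a ≡ᵇ x) ∧ (b ≡ᵇ y) ≡ true → a ≡ x × b ≡ y
∧-≡ᵇ⇒≡×≡ {a} {b} {x} {y} p =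
  let a≡ᵇx , b≡ᵇy = ∧-true⁻ (a ≡ᵇ x) p
  in ≡ᵇ⇒≡ a x (Equivalence.from T-≡ a≡ᵇx) , ≡ᵇ⇒≡ b y (Equivalence.from T-≡ b≡ᵇy)

⟦_⟧ : Bool → ℕ
⟦ b ⟧ = if b then 1 else 0

⟦⟧≡0 : ∀ {b} → b ≢ true → ⟦ b ⟧ ≡ 0
⟦⟧≡0 {false} _   = refl
⟦⟧≡0 {true}  b≢t = contradiction refl b≢t

∑< : ℕ → (ℕ → ℕ) → ℕ
∑< zero    g = 0
∑< (suc n) g = ∑< n g + g n

∑<² : ℕ → (ℕ → ℕ → ℕ) → ℕ
∑<² n G = ∑< n (λ v → ∑< n (G v))

count≡∑< : ∀ f n → count f n ≡ ∑< n (λ w → ⟦ f w ⟧)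
count≡∑< f zero    = refl
count≡∑< f (suc n) = cong (_+ ⟦ f n ⟧) (count≡∑< f n)

count-cong : ∀ {f g} n → (∀ w → f w ≡ g w) → count f n ≡ count g n
count-cong zero    f≗g = refl
count-cong (suc n) f≗g = cong₂ _+_ (count-cong n f≗g) (cong ⟦_⟧ (f≗g n))

count-stable : ∀ {f n m} → (∀ u → f u ≡ true → u < n) → n ≤′ m → count f m ≡ count f n
count-stable bd ≤′-refl = refl
count-stable {f} bd (≤′-step {m} n≤m) with f m in fm
... | true  = ⊥-elim (≤⇒≯ (≤′⇒≤ n≤m) (bd m fm))
... | false = trans (+-identityʳ _) (count-stable bd n≤m)

count-zero : ∀ {f} n → (∀ u → f u ≢ true) → count f n ≡ 0
count-zero n nowhere = count-stable {m = n} (λ u fu → ⊥-elim (nowhere u fu)) z≤′n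

count-independent : ∀ {f m n} → (∀ u → f u ≡ true → u < m) → (∀ u → f u ≡ true → u < n)
                  → count f m ≡ count f n
count-independent {m = m} {n} below-m below-n =
  trans (sym (count-stable below-m (m≤′m+n m n))) (count-stable below-n (n≤′m+n m n))

∑<-cong : ∀ n {g h} → (∀ w → w < n → g w ≡ h w) → ∑< n g ≡ ∑< n h
∑<-cong zero    g≗h = refl
∑<-cong (suc n) g≗h = cong₂ _+_ (∑<-cong n (λ w w<n → g≗h w (m≤n⇒m≤1+n w<n))) (g≗h n ≤-refl)

∑<-zero : ∀ n → ∑< n (λ _ → 0) ≡ 0
∑<-zero zero    = refl
∑<-zero (suc n) = trans (+-identityʳ _) (∑<-zero n)

∑<-+ : ∀ n {g h} → ∑< n (λ w → g w + h w) ≡ ∑< n g + ∑< n h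
∑<-+ zero    = refl
∑<-+ (suc n) {g} {h} =
  trans (cong (_+ (g n + h n)) (∑<-+ n)) (interchange (∑< n g) (∑< n h) (g n) (h n))

∑<-select : ∀ {n y g} → y < n → (∀ v → v ≢ y → g v ≡ 0) → ∑< n g ≡ g y
∑<-select {y = y} {g} y<n vanishes = go (≤⇒≤′ y<n)
  where
  open ≡-Reasoning
  go : ∀ {n} → suc y ≤′ n → ∑< n g ≡ g y
  go ≤′-refl = cong (_+ g y) (trans (∑<-cong y (λ v v<y → vanishes v (<⇒≢ v<y))) (∑<-zero y))
  go (≤′-step {n} y<n) = begin
    ∑< n g + g n  ≡⟨ cong₂ _+_ (go y<n) (vanishes n (>⇒≢ (≤′⇒≤ y<n))) ⟩
    g y + 0       ≡⟨ +-identityʳ (g y) ⟩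
    g y           ∎

∑<-even : ∀ n {g} → (∀ w → 2 ∣ g w) → 2 ∣ ∑< n g
∑<-even zero    even = 2 ∣0
∑<-even (suc n) even = ∣m∣n⇒∣m+n (∑<-even n even) (even n)

∑<²-cong : ∀ n {G H} → (∀ v w → G v w ≡ H v w) → ∑<² n G ≡ ∑<² n H
∑<²-cong n G≗H = ∑<-cong n (λ v _ → ∑<-cong n (λ w _ → G≗H v w))

∑<²-+ : ∀ n {G H} → ∑<² n (λ v w → G v w + H v w) ≡ ∑<² n G + ∑<² n H
∑<²-+ n = trans (∑<-cong n (λ v _ → ∑<-+ n)) (∑<-+ n)

∑<²-point : ∀ {n x y} {P : ℕ → ℕ → Bool} → x < n → y < n
          → (∀ {v w} → P v w ≡ true → v ≡ y × w ≡ x) → P y x ≡ true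
          → ∑<² n (λ v w → ⟦ P v w ⟧) ≡ 1
∑<²-point {n} {x} {y} {P} x<n y<n only-yx Pyx = begin
  ∑<² n (λ v w → ⟦ P v w ⟧)  ≡⟨ ∑<-select y<n row-vanishes ⟩
  ∑< n (λ w → ⟦ P y w ⟧)     ≡⟨ ∑<-select x<n (λ w w≢x → ⟦⟧≡0 (w≢x ∘ proj₂ ∘ only-yx)) ⟩
  ⟦ P y x ⟧                  ≡⟨ cong ⟦_⟧ Pyx ⟩
  1                          ∎
  where
  open ≡-Reasoning
  row-vanishes : ∀ v → v ≢ y → ∑< n (λ w → ⟦ P v w ⟧) ≡ 0
  row-vanishes v v≢y = trans (∑<-cong n (λ w _ → ⟦⟧≡0 (v≢y ∘ proj₁ ∘ only-yx))) (∑<-zero n)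

2∣n+n : ∀ n → 2 ∣ n + n
2∣n+n n = subst (2 ∣_) (cong (n +_) (+-identityʳ n)) (m∣m*n n)

∑<²-symmetric-even : ∀ n {G} → (∀ v w → G v w ≡ G w v) → (∀ v → G v v ≡ 0) → 2 ∣ ∑<² n G
∑<²-symmetric-even zero    G-sym G-diag = 2 ∣0
∑<²-symmetric-even (suc n) {G} G-sym G-diag =
  subst (2 ∣_) (sym split) (∣m∣n⇒∣m+n (∑<²-symmetric-even n G-sym G-diag) (2∣n+n S))
  where
  open ≡-Reasoning
  S = ∑< n (λ v → G v n)
  split : ∑<² (suc n) G ≡ ∑<² n G + (S + S)
  split = begin
    ∑< n (λ v → ∑< n (G v) + G v n) + (∑< n (G n) + G n n)
      ≡⟨ cong₂ _+_ (∑<-+ n) (cong₂ _+_ (∑<-cong n (λ w _ → G-sym n w)) (G-diag n)) ⟩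
    (∑<² n G + S) + (S + 0)  ≡⟨ cong ((∑<² n G + S) +_) (+-identityʳ S) ⟩
    (∑<² n G + S) + S        ≡⟨ +-assoc (∑<² n G) S S ⟩
    ∑<² n G + (S + S)        ∎

Symmetric : (ℕ → ℕ → Bool) → Set
Symmetric F = ∀ v w → F v w ≡ F w v

Loopless : (ℕ → ℕ → Bool) → Set
Loopless F = ∀ v → F v v ≡ false

EvenDegrees : ℕ → (ℕ → ℕ → Bool) → Set
EvenDegrees N F = ∀ v → 2 ∣ count (F v) N

restrict : (ℕ → Bool) → (ℕ → ℕ → Bool) → ℕ → ℕ → Bool
restrict χ F v w = χ v ∧ χ w ∧ F v w

cutSize : ℕ → (ℕ → Bool) → (ℕ → ℕ → Bool) → ℕ
cutSize N χ F = ∑<² N (λ v w → ⟦ χ v ∧ not (χ w) ∧ F v w ⟧)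

restrict-symmetric : ∀ {χ F} → Symmetric F → Symmetric (restrict χ F)
restrict-symmetric {χ} F-sym v w with χ v | χ w
... | true  | true  = F-sym v w
... | true  | false = refl
... | false | true  = refl
... | false | false = refl

restrict-loopless : ∀ {χ F} → Loopless F → Loopless (restrict χ F)
restrict-loopless {χ} F-loopless v with χ v
... | true  = F-loopless v
... | false = refl

restrict-evenDegrees : ∀ {χ F N} → (∀ {v w} → χ v ≡ true → F v w ≡ true → χ w ≡ true)
                     → EvenDegrees N F → EvenDegrees N (restrict χ F)
restrict-evenDegrees {χ} {F} {N} closed even v with χ v in χv
... | true  = subst (2 ∣_) (count-cong N (λ w → ≡true-ext (λ Fvw → cong₂ _∧_ (closed χv Fvw) Fvw)
                                                           (proj₂ ∘ ∧-true⁻ (χ w))))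
                    (even v)
... | false = subst (2 ∣_) (sym (count-zero N (λ _ ()))) (2 ∣0)

-- Handshake: the degrees inside χ add up to twice the edges inside χ plus the edges leaving χ.
cutSize-even : ∀ {N χ F} → Symmetric F → Loopless F → EvenDegrees N F → 2 ∣ cutSize N χ F
cutSize-even {N} {χ} {F} F-sym F-loopless even =
  ∣m+n∣m⇒∣n (subst (2 ∣_) (trans (∑<²-cong N split) (∑<²-+ N)) degreeSum-even) inside-even
  where
  split : ∀ v w → ⟦ χ v ∧ F v w ⟧ ≡ ⟦ restrict χ F v w ⟧ + ⟦ χ v ∧ not (χ w) ∧ F v w ⟧
  split v w with χ v | χ w
  ... | false | _     = refl
  ... | true  | true  = sym (+-identityʳ _)
  ... | true  | false = refl

  degreeSum-even : 2 ∣ ∑<² N (λ v w → ⟦ χ v ∧ F v w ⟧)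
  degreeSum-even = ∑<-even N row-even
    where
    row-even : ∀ v → 2 ∣ ∑< N (λ w → ⟦ χ v ∧ F v w ⟧)
    row-even v with χ v
    ... | true  = subst (2 ∣_) (count≡∑< (F v) N) (even v)
    ... | false = ∑<-even N (λ _ → 2 ∣0)

  inside-even : 2 ∣ ∑<² N (λ v w → ⟦ restrict χ F v w ⟧)
  inside-even = ∑<²-symmetric-even N (λ v w → cong ⟦_⟧ (restrict-symmetric {χ} F-sym v w))
                                     (λ v → cong ⟦_⟧ (restrict-loopless {χ} {F} F-loopless v))

evenDegrees⇒¬loneCutEdge : ∀ {N χ F x y} → Symmetric F → Loopless F → EvenDegrees N F
  → x < N → y < N → χ y ≡ true → χ x ≡ false
  → (∀ {v w} → χ v ≡ true → χ w ≡ false → F v w ≡ true → v ≡ y × w ≡ x)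
  → F y x ≢ true
evenDegrees⇒¬loneCutEdge {N} {χ} {F} {x} {y} F-sym F-loopless even x<N y<N χy χx leaving Fyx =
  contradiction (∣1⇒≡1 (subst (2 ∣_) cutSize≡1 (cutSize-even {N} {χ} F-sym F-loopless even))) λ ()
  where
  crossing : ∀ {v w} → χ v ∧ not (χ w) ∧ F v w ≡ true → v ≡ y × w ≡ x
  crossing {v} {w} p = let χv , q = ∧-true⁻ (χ v) p
                           ¬χw , Fvw = ∧-true⁻ (not (χ w)) q
                       in leaving χv (not-injective ¬χw) Fvw

  cutSize≡1 : cutSize N χ F ≡ 1
  cutSize≡1 = ∑<²-point x<N y<N crossing (cong₂ _∧_ χy (cong₂ _∧_ (cong not χx) Fyx))

_⊆ᴱ_ : (ℕ → ℕ → Bool) → Graph → Set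
F ⊆ᴱ G = ∀ a b → F a b ≡ true → E G a b ≡ true

record _⊆ᴳ_ (G H : Graph) : Set where
  constructor _,_
  field
    V⊆ : ∀ v → V G v ≡ true → V H v ≡ true
    E⊆ : E G ⊆ᴱ H
open _⊆ᴳ_

⊆ᴳ-trans : ∀ {G H K} → G ⊆ᴳ H → H ⊆ᴳ K → G ⊆ᴳ K
⊆ᴳ-trans (V⊆ , E⊆) (V⊆′ , E⊆′) = (λ v → V⊆′ v ∘ V⊆ v) , (λ a b → E⊆′ a b ∘ E⊆ a b)

≅⇒⊆ᴳ : ∀ {G H} → G ≅ H → G ⊆ᴳ H
≅⇒⊆ᴳ (V≡ , E≡) = (λ v p → trans (sym (V≡ v)) p) , (λ a b p → trans (sym (E≡ a b)) p)

⊆ᴳ-antisym : ∀ {G H} → G ⊆ᴳ H → H ⊆ᴳ G → G ≅ H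
⊆ᴳ-antisym (V⊆ , E⊆) (V⊇ , E⊇) =
  (λ v → ≡true-ext (V⊆ v) (V⊇ v)) , (λ a b → ≡true-ext (E⊆ a b) (E⊇ a b))

≅-trans : ∀ {G H K} → G ≅ H → H ≅ K → G ≅ K
≅-trans (V≡ , E≡) (V≡′ , E≡′) = (λ v → trans (V≡ v) (V≡′ v)) , (λ a b → trans (E≡ a b) (E≡′ a b))

⊆ᴱ-loopless : ∀ {F G} → F ⊆ᴱ G → Loopless F
⊆ᴱ-loopless {F} {G} F⊆G v with F v v in Fvv
... | true  = ⊥-elim (≡false⇒≢true (E-irr G v) (F⊆G v v Fvv))
... | false = refl

E-Vʳ : ∀ G {a b} → E G a b ≡ true → V G b ≡ true
E-Vʳ G {a} {b} e = E-V G b a (trans (E-sym G b a) e)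

circle-vertex : ∀ {G} → IsCircle G → ∃[ v ] V G v ≡ true
circle-vertex ((nonempty , _) , _) = nonempty

circle-walk : ∀ {G v u} → IsCircle G → V G v ≡ true → V G u ≡ true → Walk G v u
circle-walk ((_ , walk) , _) = walk _ _

Walk-closed : ∀ {G} (P : ℕ → Set) → (∀ {a b} → P a → E G a b ≡ true → P b)
            → ∀ {v u} → Walk G v u → P v → P u
Walk-closed P closed (here _)   Pv = Pv
Walk-closed P closed (step e w) Pv = Walk-closed P closed w (closed Pv e)

degrees-even⇒EvenDegrees : ∀ {G N} → (∀ v → V G v ≡ true → 2 ∣ deg G v)
                         → (∀ v → V G v ≡ true → v < N) → EvenDegrees N (E G)
degrees-even⇒EvenDegrees {G} {N} even below w with V G w in w∈G
... | true  = subst (2 ∣_) (count-independent (λ u → bounded G u ∘ E-Vʳ G) (λ u → below u ∘ E-Vʳ G))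
                    (even w w∈G)
... | false = subst (2 ∣_) (sym (count-zero N (λ u → ≡false⇒≢true w∈G ∘ E-V G w u))) (2 ∣0)

-- IsJoin unfolds to a product of equations, so G H x y S cannot be inferred from J:
-- call sites pass them explicitly.
module _ {G H x y S} (J : IsJoin G H x y S) where

  join-⊆ᴳˡ : G ⊆ᴳ S
  join-⊆ᴳˡ = (λ v p → trans (proj₁ J v) (cong (_∨ V H v) p))
           , (λ a b p → trans (proj₂ J a b) (cong (_∨ _) p))

  join-⊆ᴳʳ : H ⊆ᴳ S
  join-⊆ᴳʳ = (λ v p → trans (proj₁ J v) (trans (cong (V G v ∨_) p) (∨-zeroʳ (V G v))))
           , (λ a b p → trans (proj₂ J a b)
                                (trans (cong (λ h → E G a b ∨ h ∨ _) p) (∨-zeroʳ (E G a b))))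

  V-join⁻ : ∀ {v} → V S v ≡ true → V G v ≡ true ⊎ V H v ≡ true
  V-join⁻ {v} p = ∨-true⁻ (V G v) (trans (sym (proj₁ J v)) p)

  E-join⁻ : ∀ {a b} → E S a b ≡ true
          → E G a b ≡ true ⊎ E H a b ≡ true ⊎ (a ≡ x × b ≡ y) ⊎ (a ≡ y × b ≡ x)
  E-join⁻ {a} {b} p with ∨-true⁻ (E G a b) (trans (sym (proj₂ J a b)) p)
  ... | inj₁ e = inj₁ e
  ... | inj₂ q with ∨-true⁻ (E H a b) q
  ...   | inj₁ e = inj₂ (inj₁ e)
  ...   | inj₂ r = inj₂ (inj₂ (Sum.map ∧-≡ᵇ⇒≡×≡ ∧-≡ᵇ⇒≡×≡ (∨-true⁻ _ r)))

module _ {C : ℕ → Graph} where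

  Stage-circle : ∀ {i T l} → Stage C i T → l ≤′ i → IsCircle (C l)
  Stage-circle (base c _)     ≤′-refl     = c
  Stage-circle (step _ c _ _) ≤′-refl     = c
  Stage-circle (step S _ _ _) (≤′-step p) = Stage-circle S p

  Stage-⊆ᴳ : ∀ {i T l} → Stage C i T → l ≤′ i → C l ⊆ᴳ T
  Stage-⊆ᴳ (base _ C0≅T) ≤′-refl = ≅⇒⊆ᴳ C0≅T
  Stage-⊆ᴳ (step {i} {T} {T′} {x} {y} _ _ _ J) ≤′-refl =
    join-⊆ᴳʳ {T} {C (suc i)} {x} {y} {T′} J
  Stage-⊆ᴳ (step {i} {T} {T′} {x} {y} S _ _ J) (≤′-step p) =
    ⊆ᴳ-trans (Stage-⊆ᴳ S p) (join-⊆ᴳˡ {T} {C (suc i)} {x} {y} {T′} J)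

  Stage-cover : ∀ {i T v} → Stage C i T → V T v ≡ true → ∃[ l ] l ≤′ i × V (C l) v ≡ true
  Stage-cover (base _ (V≡ , _)) p = 0 , ≤′-refl , trans (V≡ _) p
  Stage-cover (step {i} {T} {T′} {x} {y} S _ _ J) p with V-join⁻ {T} {C (suc i)} {x} {y} {T′} J p
  ... | inj₁ q = map₂ (map₁ ≤′-step) (Stage-cover S q)
  ... | inj₂ q = _ , ≤′-refl , q

  Stage-unique : ∀ {i T l l′ v} → Stage C i T → l ≤′ i → l′ ≤′ i
               → V (C l) v ≡ true → V (C l′) v ≡ true → l ≡ l′
  Stage-unique (base _ _)     ≤′-refl ≤′-refl _ _ = refl
  Stage-unique (step _ _ _ _) ≤′-refl ≤′-refl _ _ = refl
  Stage-unique (step S _ (T#H , _) _) ≤′-refl (≤′-step p′) q q′ =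
    ⊥-elim (≡false⇒≢true (T#H _ (V⊆ (Stage-⊆ᴳ S p′) _ q′)) q)
  Stage-unique (step S _ (T#H , _) _) (≤′-step p) ≤′-refl q q′ =
    ⊥-elim (≡false⇒≢true (T#H _ (V⊆ (Stage-⊆ᴳ S p) _ q)) q′)
  Stage-unique (step S _ _ _) (≤′-step p) (≤′-step p′) q q′ = Stage-unique S p p′ q q′

module EvenEdgeSetOfJoin {T H x y T′ N F} (J : IsJoin T H x y T′)
  (T#H : Disjoint T H) (x∈T : V T x ≡ true) (y∈H : V H y ≡ true)
  (below : ∀ v → V T′ v ≡ true → v < N)
  (F-sym : Symmetric F) (F⊆T′ : F ⊆ᴱ T′) (even : EvenDegrees N F) where

  private
    T⊆T′ : T ⊆ᴳ T′
    T⊆T′ = join-⊆ᴳˡ {T} {H} {x} {y} {T′} J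

    H⊆T′ : H ⊆ᴳ T′
    H⊆T′ = join-⊆ᴳʳ {T} {H} {x} {y} {T′} J

  leaving-H : ∀ {v w} → V H v ≡ true → V H w ≡ false → F v w ≡ true → v ≡ y × w ≡ x
  leaving-H v∈H w∉H Fvw with E-join⁻ {T} {H} {x} {y} {T′} J (F⊆T′ _ _ Fvw)
  ... | inj₁ e                      = ⊥-elim (≡false⇒≢true (T#H _ (E-V T _ _ e)) v∈H)
  ... | inj₂ (inj₁ e)               = ⊥-elim (≡false⇒≢true w∉H (E-Vʳ H e))
  ... | inj₂ (inj₂ (inj₁ (refl , _))) = ⊥-elim (≡false⇒≢true (T#H x x∈T) v∈H)
  ... | inj₂ (inj₂ (inj₂ yx))       = yx

  bridge∉F : F y x ≢ true
  bridge∉F = evenDegrees⇒¬loneCutEdge {N} {V H} F-sym (⊆ᴱ-loopless {G = T′} F⊆T′) even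
               (below x (V⊆ T⊆T′ x x∈T)) (below y (V⊆ H⊆T′ y y∈H))
               y∈H (T#H x x∈T) leaving-H

  edge-side : ∀ {a b} → F a b ≡ true → E T a b ≡ true ⊎ E H a b ≡ true
  edge-side {a} {b} Fab with E-join⁻ {T} {H} {x} {y} {T′} J (F⊆T′ a b Fab)
  ... | inj₁ e                          = inj₁ e
  ... | inj₂ (inj₁ e)                   = inj₂ e
  ... | inj₂ (inj₂ (inj₁ (refl , refl))) = ⊥-elim (bridge∉F (trans (F-sym y x) Fab))
  ... | inj₂ (inj₂ (inj₂ (refl , refl))) = ⊥-elim (bridge∉F Fab)

  T-closed : ∀ {v w} → V T v ≡ true → F v w ≡ true → V T w ≡ true
  T-closed v∈T Fvw with edge-side Fvw
  ... | inj₁ e = E-Vʳ T e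
  ... | inj₂ e = ⊥-elim (≡false⇒≢true (T#H _ v∈T) (E-V H _ _ e))

  below-T : ∀ v → V T v ≡ true → v < N
  below-T v = below v ∘ V⊆ T⊆T′ v

  restrict-⊆ᴱ : restrict (V T) F ⊆ᴱ T
  restrict-⊆ᴱ a b p with ∧-true⁻ (V T a) p
  ... | a∈T , q with edge-side (proj₂ (∧-true⁻ (V T b) q))
  ...   | inj₁ e = e
  ...   | inj₂ e = ⊥-elim (≡false⇒≢true (T#H a a∈T) (E-V H a b e))

  split : ∀ {a b} → F a b ≡ true → E H a b ≡ true ⊎ restrict (V T) F a b ≡ true
  split {a} {b} Fab with edge-side Fab
  ... | inj₁ e = inj₂ (cong₂ _∧_ (E-V T a b e) (cong₂ _∧_ (E-Vʳ T e) Fab))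
  ... | inj₂ e = inj₁ e

evenEdges-in-circles : ∀ {C i T N F} → Stage C i T → (∀ v → V T v ≡ true → v < N)
  → Symmetric F → F ⊆ᴱ T → EvenDegrees N F
  → ∀ {a b} → F a b ≡ true → ∃[ l ] l ≤′ i × E (C l) a b ≡ true
evenEdges-in-circles (base _ (_ , E≡)) _ _ F⊆T _ {a} {b} Fab =
  0 , ≤′-refl , trans (E≡ a b) (F⊆T a b Fab)
evenEdges-in-circles {C} {N = N} {F}
  (step {i} {T} {T′} {x} {y} S _ (T#H , _ , _ , x∈T , _ , y∈H , _) J) below F-sym F⊆T′ even Fab =
  [ (λ e → _ , ≤′-refl , e)
  , map₂ (map₁ ≤′-step)
    ∘ evenEdges-in-circles S below-T (restrict-symmetric {V T} F-sym) restrict-⊆ᴱ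
                           (restrict-evenDegrees {V T} {F} {N} T-closed even)
  ]′ (split Fab)
  where open EvenEdgeSetOfJoin {T} {C (suc i)} {x} {y} {T′} J T#H x∈T y∈H below F-sym F⊆T′ even

toℕ≤′ : ∀ {m} (i : Fin (suc m)) → toℕ i ≤′ m
toℕ≤′ i = ≤⇒≤′ (toℕ≤pred[n] i)

Stage-index : ∀ {C m T v} → Stage C m T → V T v ≡ true → Σ[ l ∈ Fin (suc m) ] V (C (toℕ l)) v ≡ true
Stage-index {C} {v = v} S p =
  let l , l≤m , v∈Cl = Stage-cover S p
      l<1+m = s≤s (≤′⇒≤ l≤m)
  in fromℕ< l<1+m , subst (λ k → V (C k) v ≡ true) (sym (toℕ-fromℕ< l<1+m)) v∈Cl

Stage-≅⇒≡ : ∀ {C m T} → Stage C m T → ∀ i j → C (toℕ i) ≅ C (toℕ j) → i ≡ j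
Stage-≅⇒≡ S i j (V≡ , _) =
  let v , v∈Ci = circle-vertex (Stage-circle S (toℕ≤′ i))
  in toℕ-injective (Stage-unique S (toℕ≤′ i) (toℕ≤′ j) v∈Ci (trans (sym (V≡ v)) v∈Ci))

module _ {C D : ℕ → Graph} {m : ℕ} {T : Graph} (SC : Stage C m T) (SD : Stage D m T) where

  circle-evenDegrees : ∀ {i} → i ≤′ m → EvenDegrees (bound T) (E (C i))
  circle-evenDegrees {i} i≤m =
    degrees-even⇒EvenDegrees {C i} (λ v v∈Ci → ∣-reflexive (sym (proj₂ (Stage-circle SC i≤m) v v∈Ci)))
                                   (λ v v∈Ci → bounded T v (V⊆ (Stage-⊆ᴳ SC i≤m) v v∈Ci))

  circle-edge-transfer : ∀ {i j a b} → i ≤′ m → j ≤′ m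
                       → V (D j) a ≡ true → E (C i) a b ≡ true → E (D j) a b ≡ true
  circle-edge-transfer {i} i≤m j≤m a∈Dj e
    with evenEdges-in-circles SD (bounded T) (E-sym (C i)) (E⊆ (Stage-⊆ᴳ SC i≤m))
                              (circle-evenDegrees i≤m) e
  ... | l , l≤m , e′ with Stage-unique SD l≤m j≤m (E-V (D l) _ _ e′) a∈Dj
  ...   | refl = e′

  shared-vertex⇒⊆ᴳ : ∀ {i j v} → i ≤′ m → j ≤′ m → V (C i) v ≡ true → V (D j) v ≡ true → C i ⊆ᴳ D j
  shared-vertex⇒⊆ᴳ {i} {j} {v} i≤m j≤m v∈Ci v∈Dj =
    Ci⊆Dj , λ a b e → circle-edge-transfer i≤m j≤m (Ci⊆Dj a (E-V (C i) a b e)) e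
    where
    Ci⊆Dj : ∀ u → V (C i) u ≡ true → V (D j) u ≡ true
    Ci⊆Dj u u∈Ci = Walk-closed (λ a → V (D j) a ≡ true)
                                (λ a∈Dj e → E-Vʳ (D j) (circle-edge-transfer i≤m j≤m a∈Dj e))
                                (circle-walk (Stage-circle SC i≤m) v∈Ci u∈Ci) v∈Dj

shared-vertex⇒≅ : ∀ {C D m T i j v} (SC : Stage C m T) (SD : Stage D m T) → i ≤′ m → j ≤′ m
                → V (C i) v ≡ true → V (D j) v ≡ true → C i ≅ D j
shared-vertex⇒≅ SC SD i≤m j≤m v∈Ci v∈Dj =
  ⊆ᴳ-antisym (shared-vertex⇒⊆ᴳ SC SD i≤m j≤m v∈Ci v∈Dj) (shared-vertex⇒⊆ᴳ SD SC j≤m i≤m v∈Dj v∈Ci)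

module _ {C D : ℕ → Graph} {m : ℕ} {T : Graph} (SC : Stage C m T) (SD : Stage D m T) where

  matching : (i : Fin (suc m)) → Σ[ j ∈ Fin (suc m) ] C (toℕ i) ≅ D (toℕ j)
  matching i =
    let v , v∈Ci = circle-vertex (Stage-circle SC (toℕ≤′ i))
        j , v∈Dj = Stage-index SD (V⊆ (Stage-⊆ᴳ SC (toℕ≤′ i)) v v∈Ci)
    in j , shared-vertex⇒≅ SC SD (toℕ≤′ i) (toℕ≤′ j) v∈Ci v∈Dj

  match : Fin (suc m) → Fin (suc m)
  match = proj₁ ∘ matching

  match-≅ : ∀ i → C (toℕ i) ≅ D (toℕ (match i))
  match-≅ = proj₂ ∘ matching

match-inverse : ∀ {C D m T} (SC : Stage C m T) (SD : Stage D m T)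
              → ∀ i → match SD SC (match SC SD i) ≡ i
match-inverse {C} {D} SC SD i =
  sym (Stage-≅⇒≡ SC i k (≅-trans {C (toℕ i)} {D (toℕ j)} {C (toℕ k)}
                                 (match-≅ SC SD i) (match-≅ SD SC j)))
  where
  j = match SC SD i
  k = match SD SC j

proposition4p13 : (k : ℕ) (C C' : ℕ → Graph) (T : Graph)
    → Determines C k T → Determines C' k T
    → Σ (Fin k ↔ Fin k) λ f → ∀ (i : Fin k) → C (toℕ i) ≅ C' (toℕ (Inverse.to f i))
proposition4p13 zero    C C' T () _
proposition4p13 (suc m) C C' T SC SD =
  mk↔ₛ′ (match SC SD) (match SD SC) (match-inverse SD SC) (match-inverse SC SD) , match-≅ SC SD
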